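{- For every $n\ge 1$, the set ${\cal ORCT}_n$ of full contractions of $X_n=\{1,\dots,n\}$ that are order-preserving or order-reversing satisfies $|{\cal ORCT}_n|=(n+1)2^{n-1}-n$.
   Context: Full transformations are maps $\alpha:X_n\to X_n$, written $x\mapsto x\alpha$. Order-preserving: $x\le y\Rightarrow x\alpha\le y\alpha$; order-reversing: $x\le y\Rightarrow x\alpha\ge y\alpha$. Contraction: $|x\alpha-y\alpha|\le|x-y|$ for all $x,y$. -}

module Defs where

open import Data.Nat using (ℕ; zero; suc; ∣_-_∣) renaming (_≤_ to _≤ℕ_; _≤?_ to _≤ℕ?_)
open import Data.Fin using (Fin; toℕ; _≤_; _≤?_)
open import Data.Fin.Properties using (all?)
open import Data.Vec using (Vec; []; _∷_; lookup)
open import Data.List using (List; []; _∷_; map; concatMap; filter; length; allFin)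
open import Data.Sum using (_⊎_)
open import Relation.Nullary using (Dec)
open import Relation.Nullary.Decidable using (_⊎-dec_; _×-dec_; _→-dec_)
open import Relation.Unary using (Decidable)

-- X_n = {1,…,n} is modelled by Fin n (i ↦ toℕ i + 1); order and distances are
-- invariant under this shift.
Transformation : ℕ → Set
Transformation n = Vec (Fin n) n

_·_ : ∀ {n} → Fin n → Transformation n → Fin n
x · α = lookup α x

IsOrderPreserving : ∀ {n} → Transformation n → Set
IsOrderPreserving {n} α = (x y : Fin n) → x ≤ y → (x · α) ≤ (y · α)

IsOrderReversing : ∀ {n} → Transformation n → Set
IsOrderReversing {n} α = (x y : Fin n) → x ≤ y → (y · α) ≤ (x · α)

IsContraction : ∀ {n} → Transformation n → Set
IsContraction {n} α =
  (x y : Fin n) → ∣ toℕ (x · α) - toℕ (y · α) ∣ ≤ℕ ∣ toℕ x - toℕ y ∣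

IsORCT : ∀ {n} → Transformation n → Set
IsORCT α = IsContraction α Data.Product.× (IsOrderPreserving α ⊎ IsOrderReversing α)
  where import Data.Product

isOrderPreserving? : ∀ {n} → Decidable (IsOrderPreserving {n})
isOrderPreserving? α = all? λ x → all? λ y → (x ≤? y) →-dec ((x · α) ≤? (y · α))

isOrderReversing? : ∀ {n} → Decidable (IsOrderReversing {n})
isOrderReversing? α = all? λ x → all? λ y → (x ≤? y) →-dec ((y · α) ≤? (x · α))

isContraction? : ∀ {n} → Decidable (IsContraction {n})
isContraction? α = all? λ x → all? λ y →
  ∣ toℕ (x · α) - toℕ (y · α) ∣ ≤ℕ? ∣ toℕ x - toℕ y ∣

isORCT? : ∀ {n} → Decidable (IsORCT {n})
isORCT? α = isContraction? α ×-dec (isOrderPreserving? α ⊎-dec isOrderReversing? α)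

allVecs : ∀ {n} k → List (Vec (Fin n) k)
allVecs zero = [] ∷ []
allVecs {n} (suc k) = concatMap (λ i → map (i ∷_) (allVecs k)) (allFin n)

allTransformations : ∀ n → List (Transformation n)
allTransformations n = allVecs n

ORCT : ∀ n → List (Transformation n)
ORCT n = filter isORCT? (allTransformations n)

module Submission where

open import Defs
open import Data.Nat using (ℕ; suc; _+_; _*_; _∸_; _^_)
open import Data.List using (length)
open import Relation.Binary.PropositionalEquality using (_≡_)

open import Algebra.Bundles using (CommutativeMonoid)
open import Data.Bool using (Bool; true; false; _∧_; _∨_; if_then_else_; T)
open import Data.Bool.Properties using (T-∧; T-∨; ∧-zeroʳ; ∧-commutativeMonoid)
open import Data.Empty using (⊥-elim)
open import Data.Fin as Fin using (Fin; toℕ)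
open import Data.List using (List; []; _∷_; _++_; map; concatMap; filter; tabulate)
open import Data.Nat using (zero; _≡ᵇ_; _≤_; _<_; z≤n; s≤s; s≤s⁻¹; ∣_-_∣)
open import Data.Nat.Properties
open import Data.Nat.Tactic.RingSolver using (solve-∀)
open import Data.Product using (_×_; _,_; proj₁; proj₂)
open import Data.Sum using (_⊎_; inj₁; inj₂)
open import Data.Unit using (tt)
open import Data.Vec using (Vec; []; _∷_; lookup)
open import Function using (_∘_; flip; _⇔_; mk⇔; Equivalence)
open import Relation.Nullary using (yes; no)
open import Relation.Unary using (Decidable)
open import Relation.Binary.PropositionalEquality
  using (refl; sym; trans; cong; cong₂; module ≡-Reasoning)

open import Algebra.Properties.CommutativeSemigroup +-commutativeSemigroup
  using () renaming (interchange to +-interchange)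
open import Algebra.Properties.CommutativeSemigroup
  (CommutativeMonoid.commutativeSemigroup ∧-commutativeMonoid)
  using () renaming (interchange to ∧-interchange)

-- Write a transformation of X_m as the word of its values
-- (x₀, …, x_{m-1}).  It is an order-preserving contraction iff every step
-- x_{i+1} - x_i is 0 or 1 (an "up-walk"), and an order-reversing contraction
-- iff every step is 0 or -1 (a "down-walk"); it is both iff it is constant.
-- By inclusion–exclusion, |ORCT_m| = #up + #down - m.  A down-walk of k steps
-- started at height a is a 0/1 word of length k with at most a ones; an
-- up-walk started at a is such a word with at most m-1-a ones.  Writing
-- paths k r for the number of 0/1 words of length k with at most r ones, both
-- #up and #down equal  P(n) = Σ_{r ≤ n} paths n r  (where m = n + 1), and
-- Pascal's rule gives P(n+1) = 2 P(n) + 2^n, whence 2 P(n) = (n + 2) 2^n.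

when : Bool → ℕ → ℕ
when b n = if b then n else 0

count : ∀ {A : Set} → (A → Bool) → List A → ℕ
count p [] = 0
count p (x ∷ xs) = when (p x) 1 + count p xs

length-filter : ∀ {A : Set} {P : A → Set} (P? : Decidable P) (p : A → Bool) →
  (∀ x → P x ⇔ T (p x)) → ∀ xs → length (filter P? xs) ≡ count p xs
length-filter P? p P⇔p [] = refl
length-filter P? p P⇔p (x ∷ xs) with P? x | p x | P⇔p x
... | yes _  | true  | _ = cong suc (length-filter P? p P⇔p xs)
... | yes Px | false | e = ⊥-elim (Equivalence.to e Px)
... | no ¬Px | true  | e = ⊥-elim (¬Px (Equivalence.from e tt))
... | no _   | false | _ = length-filter P? p P⇔p xs

count-cong : ∀ {A : Set} {p q : A → Bool} → (∀ x → p x ≡ q x) →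
  ∀ xs → count p xs ≡ count q xs
count-cong p≡q [] = refl
count-cong p≡q (x ∷ xs) = cong₂ (λ b n → when b 1 + n) (p≡q x) (count-cong p≡q xs)

count-∨ : ∀ {A : Set} (p q : A → Bool) xs →
  count (λ x → p x ∨ q x) xs + count (λ x → p x ∧ q x) xs ≡ count p xs + count q xs
count-∨ p q [] = refl
count-∨ p q (x ∷ xs) with p x | q x | count-∨ p q xs
... | true  | true  | ih = cong suc (trans (+-suc _ _) (trans (cong suc ih) (sym (+-suc _ _))))
... | true  | false | ih = cong suc ih
... | false | true  | ih = trans (cong suc ih) (sym (+-suc _ _))
... | false | false | ih = ih

count-++ : ∀ {A : Set} (p : A → Bool) xs ys → count p (xs ++ ys) ≡ count p xs + count p ys
count-++ p [] ys = refl
count-++ p (x ∷ xs) ys =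
  trans (cong (when (p x) 1 +_) (count-++ p xs ys)) (sym (+-assoc (when (p x) 1) _ _))

count-map : ∀ {A B : Set} (p : B → Bool) (f : A → B) xs → count p (map f xs) ≡ count (p ∘ f) xs
count-map p f [] = refl
count-map p f (x ∷ xs) = cong (when (p (f x)) 1 +_) (count-map p f xs)

count-false : ∀ {A : Set} (xs : List A) → count (λ _ → false) xs ≡ 0
count-false [] = refl
count-false (x ∷ xs) = count-false xs

count-∧ˡ : ∀ {A : Set} b (p : A → Bool) xs → count (λ x → b ∧ p x) xs ≡ when b (count p xs)
count-∧ˡ true p xs = refl
count-∧ˡ false p xs = count-false xs

sumTo : ℕ → (ℕ → ℕ) → ℕ
sumTo zero f = 0
sumTo (suc m) f = f 0 + sumTo m (f ∘ suc)

sumTo-cong : ∀ m {f g : ℕ → ℕ} → (∀ t → t < m → f t ≡ g t) → sumTo m f ≡ sumTo m g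
sumTo-cong zero f≡g = refl
sumTo-cong (suc m) f≡g =
  cong₂ _+_ (f≡g 0 (s≤s z≤n)) (sumTo-cong m (λ t t<m → f≡g (suc t) (s≤s t<m)))

sumTo-+ : ∀ m (f g : ℕ → ℕ) → sumTo m (λ t → f t + g t) ≡ sumTo m f + sumTo m g
sumTo-+ zero f g = refl
sumTo-+ (suc m) f g =
  trans (cong (f 0 + g 0 +_) (sumTo-+ m (f ∘ suc) (g ∘ suc))) (+-interchange (f 0) (g 0) _ _)

sumTo-const : ∀ m c → sumTo m (λ _ → c) ≡ m * c
sumTo-const zero c = refl
sumTo-const (suc m) c = cong (c +_) (sumTo-const m c)

sumTo-zero : ∀ m → sumTo m (λ _ → 0) ≡ 0
sumTo-zero m = trans (sumTo-const m 0) (*-zeroʳ m)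

sumTo-last : ∀ m f → sumTo (suc m) f ≡ sumTo m f + f m
sumTo-last zero f = +-comm (f 0) 0
sumTo-last (suc m) f =
  trans (cong (f 0 +_) (sumTo-last m (f ∘ suc))) (sym (+-assoc (f 0) _ _))

sumTo-reverse : ∀ m f → sumTo m (λ t → f (m ∸ suc t)) ≡ sumTo m f
sumTo-reverse zero f = refl
sumTo-reverse (suc m) f = begin
  f m + sumTo m (λ t → f (m ∸ suc t)) ≡⟨ cong (f m +_) (sumTo-reverse m f) ⟩
  f m + sumTo m f                     ≡⟨ +-comm (f m) _ ⟩
  sumTo m f + f m                     ≡⟨ sym (sumTo-last m f) ⟩
  sumTo (suc m) f                     ∎
  where open ≡-Reasoning

sumTo-point : ∀ {m b} (F : ℕ → ℕ) → b < m → sumTo m (λ t → when (t ≡ᵇ b) (F t)) ≡ F b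
sumTo-point {suc m} {zero} F _ = trans (cong (F 0 +_) (sumTo-zero m)) (+-identityʳ (F 0))
sumTo-point {suc m} {suc b} F (s≤s b<m) = sumTo-point (F ∘ suc) b<m

sumTo-point-beyond : ∀ {m b} (F : ℕ → ℕ) → m ≤ b → sumTo m (λ t → when (t ≡ᵇ b) (F t)) ≡ 0
sumTo-point-beyond {zero} F _ = refl
sumTo-point-beyond {suc m} {suc b} F (s≤s m≤b) = sumTo-point-beyond (F ∘ suc) m≤b

when-∨ : ∀ x y n → x ∧ y ≡ false → when (x ∨ y) n ≡ when x n + when y n
when-∨ true  true  n ()
when-∨ true  false n _ = sym (+-identityʳ n)
when-∨ false y     n _ = refl

sumTo-when-∨ : ∀ m (x y : ℕ → Bool) (F : ℕ → ℕ) → (∀ t → x t ∧ y t ≡ false) →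
  sumTo m (λ t → when (x t ∨ y t) (F t))
    ≡ sumTo m (λ t → when (x t) (F t)) + sumTo m (λ t → when (y t) (F t))
sumTo-when-∨ m x y F disjoint =
  trans (sumTo-cong m (λ t _ → when-∨ (x t) (y t) (F t) (disjoint t))) (sumTo-+ m _ _)

headed : ∀ {m k} → (ℕ → Vec (Fin m) k → Bool) → Vec (Fin m) (suc k) → Bool
headed h (x ∷ w) = h (toℕ x) w

count-heads : ∀ {m k} (h : ℕ → Vec (Fin m) k → Bool) (ws : List (Vec (Fin m) k))
  {j} (φ : Fin j → Fin m) (f : ℕ → ℕ) → (∀ i → toℕ (φ i) ≡ f (toℕ i)) →
  count (headed h) (concatMap (λ x → map (x ∷_) ws) (tabulate φ))
    ≡ sumTo j (λ t → count (h (f t)) ws)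
count-heads h ws {zero} φ f φ≡f = refl
count-heads {m} {k} h ws {suc j} φ f φ≡f = begin
  count (headed h) (map (φ Fin.zero ∷_) ws ++ rest)
    ≡⟨ count-++ (headed h) (map (φ Fin.zero ∷_) ws) rest ⟩
  count (headed h) (map (φ Fin.zero ∷_) ws) + count (headed h) rest
    ≡⟨ cong₂ _+_ (count-map (headed h) (φ Fin.zero ∷_) ws)
                 (count-heads h ws (φ ∘ Fin.suc) (f ∘ suc) (φ≡f ∘ Fin.suc)) ⟩
  count (h (toℕ (φ Fin.zero))) ws + sumTo j (λ t → count (h (f (suc t))) ws)
    ≡⟨ cong (λ a → count (h a) ws + _) (φ≡f Fin.zero) ⟩
  sumTo (suc j) (λ t → count (h (f t)) ws)
    ∎
  where
  open ≡-Reasoning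
  rest : List (Vec (Fin m) (suc k))
  rest = concatMap (λ x → map (x ∷_) ws) (tabulate (φ ∘ Fin.suc))

count-allVecs : ∀ {m} k (h : ℕ → Vec (Fin m) k → Bool) →
  count (headed h) (allVecs {m} (suc k)) ≡ sumTo m (λ t → count (h t) (allVecs k))
count-allVecs k h = count-heads h (allVecs k) (λ x → x) (λ t → t) (λ _ → refl)

-- Walks

walk : ∀ {m k} → (ℕ → ℕ → Bool) → ℕ → Vec (Fin m) k → Bool
walk step a [] = true
walk step a (y ∷ w) = step a (toℕ y) ∧ walk step (toℕ y) w

walks : ∀ m → (ℕ → ℕ → Bool) → ℕ → ℕ → ℕ
walks m step k a = count (walk step a) (allVecs {m} k)

walks-suc : ∀ {m} step k a →
  walks m step (suc k) a ≡ sumTo m (λ t → when (step a t) (walks m step k t))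
walks-suc {m} step k a = begin
  count (walk step a) (allVecs {m} (suc k))
    ≡⟨ count-cong (λ { (y ∷ w) → refl }) (allVecs {m} (suc k)) ⟩
  count (headed (λ t w → step a t ∧ walk step t w)) (allVecs {m} (suc k))
    ≡⟨ count-allVecs {m} k (λ t w → step a t ∧ walk step t w) ⟩
  sumTo m (λ t → count (λ w → step a t ∧ walk step t w) (allVecs k))
    ≡⟨ sumTo-cong m (λ t _ → count-∧ˡ (step a t) (walk step t) (allVecs k)) ⟩
  sumTo m (λ t → when (step a t) (walks m step k t))
    ∎
  where open ≡-Reasoning

Stay Up Down : ℕ → ℕ → Bool
Stay a t = t ≡ᵇ a
Up   a t = (t ≡ᵇ a) ∨ (t ≡ᵇ suc a)
Down a t = (t ≡ᵇ a) ∨ (suc t ≡ᵇ a)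

up-disjoint : ∀ t a → (t ≡ᵇ a) ∧ (t ≡ᵇ suc a) ≡ false
up-disjoint zero    zero    = refl
up-disjoint zero    (suc a) = refl
up-disjoint (suc t) zero    = refl
up-disjoint (suc t) (suc a) = up-disjoint t a

down-disjoint : ∀ t a → (t ≡ᵇ a) ∧ (suc t ≡ᵇ a) ≡ false
down-disjoint zero    zero    = refl
down-disjoint zero    (suc a) = refl
down-disjoint (suc t) zero    = refl
down-disjoint (suc t) (suc a) = down-disjoint t a

up∧down≡stay : ∀ a t → Up a t ∧ Down a t ≡ Stay a t
up∧down≡stay zero    zero    = refl
up∧down≡stay zero    (suc t) = ∧-zeroʳ (t ≡ᵇ 0)
up∧down≡stay (suc a) zero    = refl
up∧down≡stay (suc a) (suc t) = up∧down≡stay a t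

walk-up∧down≡stay : ∀ {m k} a (w : Vec (Fin m) k) →
  walk Up a w ∧ walk Down a w ≡ walk Stay a w
walk-up∧down≡stay a [] = refl
walk-up∧down≡stay a (y ∷ w) =
  trans (∧-interchange (Up a (toℕ y)) _ (Down a (toℕ y)) _)
        (cong₂ _∧_ (up∧down≡stay a (toℕ y)) (walk-up∧down≡stay (toℕ y) w))

-- paths k r is the number of 0/1 words of length k with at most r ones:
-- by Pascal's rule, split on the last letter.  `prev f r` is f (r - 1),
-- with the convention f (-1) = 0.
prev : (ℕ → ℕ) → ℕ → ℕ
prev f zero = 0
prev f (suc r) = f r

paths : ℕ → ℕ → ℕ
paths zero r = 1
paths (suc k) r = paths k r + prev (paths k) r

walks-Stay : ∀ {m} k a → a < m → walks m Stay k a ≡ 1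
walks-Stay zero a _ = refl
walks-Stay {m} (suc k) a a<m = begin
  walks m Stay (suc k) a                         ≡⟨ walks-suc {m} Stay k a ⟩
  sumTo m (λ t → when (t ≡ᵇ a) (walks m Stay k t))
    ≡⟨ sumTo-cong m (λ t t<m → cong (when (t ≡ᵇ a)) (walks-Stay k t t<m)) ⟩
  sumTo m (λ t → when (t ≡ᵇ a) 1)                ≡⟨ sumTo-point (λ _ → 1) a<m ⟩
  1                                              ∎
  where open ≡-Reasoning

-- A down-walk from a never goes below 0, so it may fall at most a times.
walks-Down : ∀ {m} k a → a < m → walks m Down k a ≡ paths k a
walks-Down zero a _ = refl
walks-Down {m} (suc k) a a<m = begin
  walks m Down (suc k) a
    ≡⟨ walks-suc {m} Down k a ⟩
  sumTo m (λ t → when (Down a t) (walks m Down k t))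
    ≡⟨ sumTo-cong m (λ t t<m → cong (when (Down a t)) (walks-Down k t t<m)) ⟩
  sumTo m (λ t → when (Down a t) (paths k t))
    ≡⟨ sumTo-when-∨ m (_≡ᵇ a) (λ t → suc t ≡ᵇ a) (paths k) (λ t → down-disjoint t a) ⟩
  sumTo m (λ t → when (t ≡ᵇ a) (paths k t)) + sumTo m (λ t → when (suc t ≡ᵇ a) (paths k t))
    ≡⟨ cong₂ _+_ (sumTo-point (paths k) a<m) (fall a a<m) ⟩
  paths k a + prev (paths k) a
    ∎
  where
  open ≡-Reasoning
  fall : ∀ a → a < m → sumTo m (λ t → when (suc t ≡ᵇ a) (paths k t)) ≡ prev (paths k) a
  fall zero    _   = sumTo-zero m
  fall (suc a) a<m = sumTo-point (paths k) (<-trans (n<1+n a) a<m)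

-- An up-walk from a in Fin (suc p) never exceeds p, so it may rise at most
-- p - a times.
walks-Up : ∀ {p} k a → a ≤ p → walks (suc p) Up k a ≡ paths k (p ∸ a)
walks-Up zero a _ = refl
walks-Up {p} (suc k) a a≤p = begin
  walks m Up (suc k) a
    ≡⟨ walks-suc {m} Up k a ⟩
  sumTo m (λ t → when (Up a t) (walks m Up k t))
    ≡⟨ sumTo-cong m (λ t t<m → cong (when (Up a t)) (walks-Up k t (s≤s⁻¹ t<m))) ⟩
  sumTo m (λ t → when (Up a t) (room t))
    ≡⟨ sumTo-when-∨ m (_≡ᵇ a) (_≡ᵇ suc a) room (λ t → up-disjoint t a) ⟩
  sumTo m (λ t → when (t ≡ᵇ a) (room t)) + sumTo m (λ t → when (t ≡ᵇ suc a) (room t))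
    ≡⟨ cong₂ _+_ (sumTo-point room (s≤s a≤p)) (rise (m≤n⇒m<n∨m≡n a≤p)) ⟩
  paths k (p ∸ a) + prev (paths k) (p ∸ a)
    ∎
  where
  open ≡-Reasoning
  m : ℕ
  m = suc p
  room : ℕ → ℕ
  room t = paths k (p ∸ t)
  rise : a < p ⊎ a ≡ p →
    sumTo m (λ t → when (t ≡ᵇ suc a) (room t)) ≡ prev (paths k) (p ∸ a)
  rise (inj₁ a<p) = trans (sumTo-point room (s≤s a<p))
                          (cong (prev (paths k)) (sym (+-∸-assoc 1 a<p)))
  rise (inj₂ refl) = trans (sumTo-point-beyond {m} {suc a} room ≤-refl)
                           (cong (prev (paths k)) (sym (n∸n≡0 a)))

-- Monotone contractions are walks

module MonotoneWalks
  (_≼_ : ℕ → ℕ → Set)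
  (≼-refl : ∀ {a} → a ≼ a)
  (≼-trans : ∀ {a b c} → a ≼ b → b ≼ c → a ≼ c)
  (step : ℕ → ℕ → Bool)
  (step-sound : ∀ a b → T (step a b) → a ≼ b × ∣ a - b ∣ ≤ 1)
  (step-complete : ∀ a b → a ≼ b → ∣ a - b ∣ ≤ 1 → T (step a b))
  where

  Monotone Contracting : ∀ {m k} → Vec (Fin m) k → Set
  Monotone {m} {k} v = (x y : Fin k) → x Fin.≤ y → toℕ (lookup v x) ≼ toℕ (lookup v y)
  Contracting {m} {k} v =
    (x y : Fin k) → ∣ toℕ (lookup v x) - toℕ (lookup v y) ∣ ≤ ∣ toℕ x - toℕ y ∣

  private
    ∧-fst : ∀ {x y} → T (x ∧ y) → T x
    ∧-fst = proj₁ ∘ Equivalence.to T-∧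
    ∧-snd : ∀ {x y} → T (x ∧ y) → T y
    ∧-snd = proj₂ ∘ Equivalence.to T-∧

  walk-reach : ∀ {m k} a (w : Vec (Fin m) k) → T (walk step a w) → (j : Fin k) →
    a ≼ toℕ (lookup w j) × ∣ a - toℕ (lookup w j) ∣ ≤ suc (toℕ j)
  walk-reach a (y ∷ w) c Fin.zero = step-sound a (toℕ y) (∧-fst c)
  walk-reach a (y ∷ w) c (Fin.suc j)
    with step-sound a (toℕ y) (∧-fst c) | walk-reach (toℕ y) w (∧-snd c) j
  ... | a≼y , a~y | y≼z , y~z =
    ≼-trans a≼y y≼z , ≤-trans (∣-∣-triangle a (toℕ y) _) (+-mono-≤ a~y y~z)

  walk⇒monotone : ∀ {m k} (x : Fin m) (w : Vec (Fin m) k) →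
    T (walk step (toℕ x) w) → Monotone (x ∷ w)
  walk⇒monotone x w c Fin.zero    Fin.zero    _ = ≼-refl
  walk⇒monotone x w c Fin.zero    (Fin.suc j) _ = proj₁ (walk-reach (toℕ x) w c j)
  walk⇒monotone x (y ∷ w) c (Fin.suc i) (Fin.suc j) (s≤s i≤j) =
    walk⇒monotone y w (∧-snd c) i j i≤j

  walk⇒contracting : ∀ {m k} (x : Fin m) (w : Vec (Fin m) k) →
    T (walk step (toℕ x) w) → Contracting (x ∷ w)
  walk⇒contracting x w c Fin.zero Fin.zero = ≤-reflexive (∣n-n∣≡0 (toℕ x))
  walk⇒contracting x w c Fin.zero (Fin.suc j) = proj₂ (walk-reach (toℕ x) w c j)
  walk⇒contracting x w c (Fin.suc i) Fin.zero
    rewrite ∣-∣-comm (toℕ (lookup w i)) (toℕ x) = proj₂ (walk-reach (toℕ x) w c i)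
  walk⇒contracting x (y ∷ w) c (Fin.suc i) (Fin.suc j) = walk⇒contracting y w (∧-snd c) i j

  monotone-contracting⇒walk : ∀ {m k} (x : Fin m) (w : Vec (Fin m) k) →
    Monotone (x ∷ w) → Contracting (x ∷ w) → T (walk step (toℕ x) w)
  monotone-contracting⇒walk x [] mono con = tt
  monotone-contracting⇒walk x (y ∷ w) mono con = Equivalence.from T-∧
    ( step-complete (toℕ x) (toℕ y) (mono Fin.zero (Fin.suc Fin.zero) z≤n)
                                    (con Fin.zero (Fin.suc Fin.zero))
    , monotone-contracting⇒walk y w (λ i j i≤j → mono (Fin.suc i) (Fin.suc j) (s≤s i≤j))
                                    (λ i j → con (Fin.suc i) (Fin.suc j)))

  walk⇔ : ∀ {m k} (x : Fin m) (w : Vec (Fin m) k) →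
    T (walk step (toℕ x) w) ⇔ (Monotone (x ∷ w) × Contracting (x ∷ w))
  walk⇔ x w = mk⇔ (λ c → walk⇒monotone x w c , walk⇒contracting x w c)
                  (λ (mono , con) → monotone-contracting⇒walk x w mono con)

up-sound : ∀ a b → T (Up a b) → a ≤ b × ∣ a - b ∣ ≤ 1
up-sound zero    zero          _ = z≤n , z≤n
up-sound zero    (suc zero)    _ = z≤n , ≤-refl
up-sound (suc a) (suc b)       u with up-sound a b u
... | a≤b , a~b = s≤s a≤b , a~b

up-complete : ∀ a b → a ≤ b → ∣ a - b ∣ ≤ 1 → T (Up a b)
up-complete zero    zero          _         _ = tt
up-complete zero    (suc zero)    _         _ = tt
up-complete zero    (suc (suc b)) _         (s≤s ())
up-complete (suc a) (suc b)       (s≤s a≤b) a~b = up-complete a b a≤b a~b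

down-sound : ∀ a b → T (Down a b) → b ≤ a × ∣ a - b ∣ ≤ 1
down-sound zero          zero    _ = z≤n , z≤n
down-sound (suc zero)    zero    _ = z≤n , ≤-refl
down-sound (suc a)       (suc b) d with down-sound a b d
... | b≤a , a~b = s≤s b≤a , a~b

down-complete : ∀ a b → b ≤ a → ∣ a - b ∣ ≤ 1 → T (Down a b)
down-complete zero          zero    _         _ = tt
down-complete (suc zero)    zero    _         _ = tt
down-complete (suc (suc a)) zero    _         (s≤s ())
down-complete (suc a)       (suc b) (s≤s b≤a) a~b = down-complete a b b≤a a~b

open MonotoneWalks _≤_ ≤-refl ≤-trans Up up-sound up-complete
  using () renaming (walk⇔ to up-walk⇔)
open MonotoneWalks (flip _≤_) ≤-refl (flip ≤-trans) Down down-sound down-complete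
  using () renaming (walk⇔ to down-walk⇔)

upWalk downWalk : ∀ {m k} → Vec (Fin m) (suc k) → Bool
upWalk = headed (walk Up)
downWalk = headed (walk Down)

isORCT⇔walk : ∀ {n} (α : Transformation (suc n)) → IsORCT α ⇔ T (upWalk α ∨ downWalk α)
isORCT⇔walk (x ∷ w) = mk⇔ to from
  where
  to : IsORCT (x ∷ w) → T (upWalk (x ∷ w) ∨ downWalk (x ∷ w))
  to (con , inj₁ mono) = Equivalence.from T-∨ (inj₁ (Equivalence.from (up-walk⇔ x w) (mono , con)))
  to (con , inj₂ anti) = Equivalence.from T-∨ (inj₂ (Equivalence.from (down-walk⇔ x w) (anti , con)))
  from : T (upWalk (x ∷ w) ∨ downWalk (x ∷ w)) → IsORCT (x ∷ w)
  from c with Equivalence.to T-∨ c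
  ... | inj₁ u = let (mono , con) = Equivalence.to (up-walk⇔ x w) u in con , inj₁ mono
  ... | inj₂ d = let (anti , con) = Equivalence.to (down-walk⇔ x w) d in con , inj₂ anti

pathSum : ℕ → ℕ
pathSum n = sumTo (suc n) (paths n)

-- With at least k allowed ones every word of length k counts.
paths-full : ∀ k r → k ≤ r → paths k r ≡ 2 ^ k
paths-full zero    r       _         = refl
paths-full (suc k) (suc r) (s≤s k≤r) =
  trans (cong₂ _+_ (paths-full k (suc r) (m≤n⇒m≤1+n k≤r)) (paths-full k r k≤r))
        (cong (2 ^ k +_) (sym (+-identityʳ (2 ^ k))))

-- Summing Pascal's rule over r ≤ k + 1:  P(k+1) = P(k) + 2^k + P(k).
pathSum-suc : ∀ k → pathSum (suc k) ≡ pathSum k + 2 ^ k + pathSum k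
pathSum-suc k = begin
  (paths k 0 + 0) + sumTo (suc k) (λ r → paths k (suc r) + paths k r)
    ≡⟨ cong₂ _+_ (+-identityʳ (paths k 0)) (sumTo-+ (suc k) (paths k ∘ suc) (paths k)) ⟩
  paths k 0 + (sumTo (suc k) (paths k ∘ suc) + pathSum k)
    ≡⟨ sym (+-assoc (paths k 0) _ _) ⟩
  sumTo (suc (suc k)) (paths k) + pathSum k
    ≡⟨ cong (_+ pathSum k) (sumTo-last (suc k) (paths k)) ⟩
  pathSum k + paths k (suc k) + pathSum k
    ≡⟨ cong (λ x → pathSum k + x + pathSum k) (paths-full k (suc k) (n≤1+n k)) ⟩
  pathSum k + 2 ^ k + pathSum k
    ∎
  where open ≡-Reasoning

pathSum-double : ∀ n → pathSum n + pathSum n ≡ (suc n + 1) * 2 ^ n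
pathSum-double zero = refl
pathSum-double (suc k) = begin
  pathSum (suc k) + pathSum (suc k)
    ≡⟨ cong₂ _+_ (pathSum-suc k) (pathSum-suc k) ⟩
  (P + X + P) + (P + X + P)         ≡⟨ regroup P X ⟩
  2 * (P + P) + 2 * X               ≡⟨ cong (λ y → 2 * y + 2 * X) (pathSum-double k) ⟩
  2 * ((suc k + 1) * X) + 2 * X     ≡⟨ collect k X ⟩
  (suc (suc k) + 1) * (2 * X)       ∎
  where
  open ≡-Reasoning
  P X : ℕ
  P = pathSum k
  X = 2 ^ k
  regroup : ∀ P X → (P + X + P) + (P + X + P) ≡ 2 * (P + P) + 2 * X
  regroup = solve-∀
  collect : ∀ k X → 2 * ((suc k + 1) * X) + 2 * X ≡ (suc (suc k) + 1) * (2 * X)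
  collect = solve-∀

count-upWalks : ∀ n → count upWalk (allVecs {suc n} (suc n)) ≡ pathSum n
count-upWalks n = begin
  count upWalk (allVecs {suc n} (suc n))
    ≡⟨ count-allVecs n (walk Up) ⟩
  sumTo (suc n) (walks (suc n) Up n)
    ≡⟨ sumTo-cong (suc n) (λ a a<m → walks-Up n a (s≤s⁻¹ a<m)) ⟩
  sumTo (suc n) (λ a → paths n (n ∸ a))
    ≡⟨ sumTo-reverse (suc n) (paths n) ⟩
  pathSum n
    ∎
  where open ≡-Reasoning

count-downWalks : ∀ n → count downWalk (allVecs {suc n} (suc n)) ≡ pathSum n
count-downWalks n =
  trans (count-allVecs n (walk Down)) (sumTo-cong (suc n) (λ a a<m → walks-Down n a a<m))

count-constantWalks : ∀ n →
  count (λ v → upWalk v ∧ downWalk v) (allVecs {suc n} (suc n)) ≡ suc n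
count-constantWalks n = begin
  count (λ v → upWalk v ∧ downWalk v) (allVecs {suc n} (suc n))
    ≡⟨ count-cong (λ { (x ∷ w) → walk-up∧down≡stay (toℕ x) w }) (allVecs {suc n} (suc n)) ⟩
  count (headed (walk Stay)) (allVecs {suc n} (suc n))
    ≡⟨ count-allVecs n (walk Stay) ⟩
  sumTo (suc n) (walks (suc n) Stay n)
    ≡⟨ sumTo-cong (suc n) (λ a a<m → walks-Stay n a a<m) ⟩
  sumTo (suc n) (λ _ → 1)
    ≡⟨ trans (sumTo-const (suc n) 1) (*-identityʳ (suc n)) ⟩
  suc n
    ∎
  where open ≡-Reasoning

corollary3p6 : (n : ℕ) → length (ORCT (suc n)) ≡ (suc n + 1) * 2 ^ n ∸ suc n
corollary3p6 n = begin
  length (ORCT (suc n))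
    ≡⟨ length-filter isORCT? (λ v → upWalk v ∨ downWalk v) isORCT⇔walk vs ⟩
  count (λ v → upWalk v ∨ downWalk v) vs
    ≡⟨ sym (m+n∸n≡m _ (count (λ v → upWalk v ∧ downWalk v) vs)) ⟩
  (count (λ v → upWalk v ∨ downWalk v) vs + count (λ v → upWalk v ∧ downWalk v) vs)
    ∸ count (λ v → upWalk v ∧ downWalk v) vs
    ≡⟨ cong₂ _∸_ (count-∨ upWalk downWalk vs) (count-constantWalks n) ⟩
  (count upWalk vs + count downWalk vs) ∸ suc n
    ≡⟨ cong (_∸ suc n) (cong₂ _+_ (count-upWalks n) (count-downWalks n)) ⟩
  (pathSum n + pathSum n) ∸ suc n
    ≡⟨ cong (_∸ suc n) (pathSum-double n) ⟩
  (suc n + 1) * 2 ^ n ∸ suc n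
    ∎
  where
  open ≡-Reasoning
  vs : List (Transformation (suc n))
  vs = allVecs (suc n)
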